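{- Let $K$ be a unital commutative $\mathbb{Q}$-algebra and $W=\mathbb{N}^+$. Then the graded $K$-Hopf algebra homomorphism $\mathcal{T}_W:{\mathcal N}Sym\to\mathcal{H}_{GL}^W$ is injective.
   Context: ${\mathcal N}Sym$ is the free associative $K$-algebra on noncommuting generators $\Lambda_1,\Lambda_2,\dots$ (noncommutative symmetric functions), graded with $\Lambda_m$ of weight $m$ and with its standard Hopf structure; $\lambda(t)=1+\sum_{m\ge1}t^m\Lambda_m$. Trees: $W$-labeled rooted trees (vertices labeled by elements of $W$), isomorphisms preserving root and labels; $|T|$ sum of labels; $\alpha(T)=|\mathrm{Aut}(T)|$. $B_+(T_1,\dots,T_k)$ is obtained by adding a new root labeled $0$ (weight $0$) joined to the roots of the $T_i$; $\bar{\mathbb{T}}^W$ is the set of all such trees ($k\ge0$). $\mathcal{H}_{GL}^W$ is the Grossman–Larson Hopf algebra: $K$-span of $\bar{\mathbb{T}}^W$, product $B_+(T_1,\dots,T_k)\cdot S$ = sum of all trees obtained by joining each root of $T_1,\dots,T_k$ by an edge to some vertex of $S$, unit $B_+()$, coproduct $\Delta B_+(T_1,\dots,T_k)=\sum_{I\sqcup J=\{1..k\}}B_+(T_I)\otimes B_+(T_J)$, graded by $|T|$. $\mathcal{T}_W$ is the $K$-algebra homomorphism with $\mathcal{T}_W(\lambda(t))=\sum t^{|T|}(-1)^{o(T)}T/\alpha(T)$ (coefficientwise), the sum over $T\in\bar{\mathbb{T}}^W$ all of whose non-root vertices are children of the root, $o(T)$ the number of children of the root; it is known to be a graded Hopf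 algebra homomorphism. -}

module Defs where

open import Level using (Level)
open import Data.Bool using (Bool; true; false; _∧_; if_then_else_)
open import Data.Nat using (ℕ; zero; suc; _≤ᵇ_) renaming (_*_ to _*ℕ_)
open import Data.Nat using () renaming (_≡ᵇ_ to _==ℕ_)
open import Data.Nat using (_!)
open import Data.List using (List; []; _∷_; _++_; map; concatMap; foldr; filter)
open import Data.Maybe using (Maybe; just; nothing)
import Data.Maybe as Maybe
open import Data.Product using (_×_; _,_)
open import Data.Integer using (ℤ; +_; -_)
open import Data.Rational using (ℚ; _/_; 0ℚ)
import Data.Rational.Properties as ℚP
open import Data.List.Properties using (≡-dec)
import Data.Nat.Properties as ℕP
open import Relation.Nullary using (yes; no; Dec)
open import Relation.Nullary.Decidable using (T?)
open import Relation.Binary.PropositionalEquality using (_≡_; refl)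
open import Algebra.Bundles using (CommutativeRing)
open import Algebra.Morphism.Structures using (module RingMorphisms)

data ℕ⁺ : Set where
  1+_ : ℕ → ℕ⁺

val : ℕ⁺ → ℕ
val (1+ n) = suc n

_==⁺_ : ℕ⁺ → ℕ⁺ → Bool
(1+ m) ==⁺ (1+ n) = m ==ℕ n

_≟⁺_ : (a b : ℕ⁺) → Dec (a ≡ b)
(1+ m) ≟⁺ (1+ n) with m ℕP.≟ n
... | yes refl = yes refl
... | no m≢n = no λ { refl → m≢n refl }

-- W-labeled rooted trees (children given as a list; order is irrelevant
-- up to isomorphism, see isoT below).

data Tree : Set where
  node : ℕ⁺ → List Tree → Tree

-- An element B₊(T₁,…,Tₖ) of \bar{𝕋}^W (new root labeled 0) is represented by
-- the list [T₁,…,Tₖ] of subtrees of the root.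
Forest : Set
Forest = List Tree

mutual
  isoT : Tree → Tree → Bool
  isoT (node a ts) (node b ss) = (a ==⁺ b) ∧ isoF ts ss

  isoF : List Tree → List Tree → Bool
  isoF [] [] = true
  isoF [] (_ ∷ _) = false
  isoF (t ∷ ts) ss = isoF-aux ts (remove t ss)

  isoF-aux : List Tree → Maybe (List Tree) → Bool
  isoF-aux ts nothing = false
  isoF-aux ts (just ss') = isoF ts ss'

  remove : Tree → List Tree → Maybe (List Tree)
  remove t [] = nothing
  remove t (s ∷ ss) = if isoT t s then just ss else Maybe.map (s ∷_) (remove t ss)

-- |Aut(T)|: product of the automorphism numbers of the children times the
-- factorials of the multiplicities of the isomorphism classes of children.
insertClass : Tree → List (Tree × ℕ) → List (Tree × ℕ)
insertClass t [] = (t , 1) ∷ []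
insertClass t ((s , k) ∷ r) = if isoT t s then (s , suc k) ∷ r else (s , k) ∷ insertClass t r

classes : List Tree → List (Tree × ℕ)
classes = foldr insertClass []

factMults : List (Tree × ℕ) → ℕ
factMults [] = 1
factMults ((_ , k) ∷ r) = (k !) *ℕ factMults r

mutual
  autT : Tree → ℕ
  autT (node _ cs) = autF cs

  autF : List Tree → ℕ
  autF cs = autProd cs *ℕ factMults (classes cs)

  autProd : List Tree → ℕ
  autProd [] = 1
  autProd (c ∷ cs) = autT c *ℕ autProd cs

splits : {A : Set} → List A → List (List A × List A)
splits [] = ([] , []) ∷ []
splits (x ∷ xs) = concatMap (λ { (I , J) → (x ∷ I , J) ∷ (I , x ∷ J) ∷ [] }) (splits xs)

mutual
  graftT : List Tree → Tree → List Tree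
  graftT ts (node a cs) =
    concatMap (λ { (I , J) → map (λ cs' → node a (I ++ cs')) (distF J cs) }) (splits ts)

  distF : List Tree → List Tree → List (List Tree)
  distF [] [] = [] ∷ []
  distF (_ ∷ _) [] = []
  distF ts (c ∷ cs) =
    concatMap (λ { (I , J) → concatMap (λ c' → map (c' ∷_) (distF J cs)) (graftT I c) }) (splits ts)

-- B₊(T₁,…,Tₖ) · B₊(S₁,…,Sₘ) as a list of basis trees (with multiplicity):
-- each root of the Tᵢ is joined to some vertex of B₊(S₁,…,Sₘ) (root included).
prodF : Forest → Forest → List Forest
prodF ts S = concatMap (λ { (I , J) → map (I ++_) (distF J S) }) (splits ts)

inc : List ℕ⁺ → List ℕ⁺
inc [] = []
inc ((1+ a) ∷ c) = (1+ suc a) ∷ c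

compositions : ℕ → List (List ℕ⁺)
compositions zero = [] ∷ []
compositions (suc zero) = ((1+ 0) ∷ []) ∷ []
compositions (suc (suc n)) = concatMap (λ c → ((1+ 0) ∷ c) ∷ inc c ∷ []) (compositions (suc n))

nonincreasing : List ℕ⁺ → Bool
nonincreasing [] = true
nonincreasing (a ∷ []) = true
nonincreasing (a ∷ b ∷ r) = (val b ≤ᵇ val a) ∧ nonincreasing (b ∷ r)

partitions : ℕ → List (List ℕ⁺)
partitions m = filter (λ p → T? (nonincreasing p)) (compositions m)

corolla : List ℕ⁺ → Forest
corolla = map (λ a → node a [])

len : {A : Set} → List A → ℕ
len [] = 0
len (_ ∷ r) = suc (len r)

signℤ : ℕ → ℤ
signℤ zero = + 1
signℤ (suc k) = - signℤ k

-- (-1)^k / α  as a rational number (α is never 0; the zero case is unreachable)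
signOver : ℕ → ℕ → ℚ
signOver k zero = 0ℚ
signOver k (suc a) = signℤ k / suc a

IsℚAlgebra : ∀ {c ℓ} (K : CommutativeRing c ℓ) → (ℚ → CommutativeRing.Carrier K) → Set ℓ
IsℚAlgebra K ι =
  RingMorphisms.IsRingHomomorphism (CommutativeRing.rawRing ℚP.+-*-commutativeRing) (CommutativeRing.rawRing K) ι

module Construction {c ℓ} (K : CommutativeRing c ℓ) (ι : ℚ → CommutativeRing.Carrier K) where
  open CommutativeRing K

  -- 𝒩Sym: finite K-linear combinations of words Λ_{a₁}⋯Λ_{aₖ} (aᵢ ∈ ℕ⁺)
  NSym : Set c
  NSym = List (Carrier × List ℕ⁺)

  coeffN : List ℕ⁺ → NSym → Carrier
  coeffN w [] = 0#
  coeffN w ((a , v) ∷ r) with ≡-dec _≟⁺_ v w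
  ... | yes _ = a + coeffN w r
  ... | no _ = coeffN w r

  _≈N_ : NSym → NSym → Set ℓ
  x ≈N y = ∀ w → coeffN w x ≈ coeffN w y

  -- ℋ_GL^W: finite K-linear combinations of elements of \bar{𝕋}^W
  HGL : Set c
  HGL = List (Carrier × Forest)

  coeffH : Forest → HGL → Carrier
  coeffH F [] = 0#
  coeffH F ((a , G) ∷ r) = if isoF G F then a + coeffH F r else coeffH F r

  _≈H_ : HGL → HGL → Set ℓ
  x ≈H y = ∀ F → coeffH F x ≈ coeffH F y

  unitH : HGL
  unitH = (1# , []) ∷ []

  _*H_ : HGL → HGL → HGL
  x *H y = concatMap (λ { (a , F) → concatMap (λ { (b , G) → map (λ H → (a * b , H)) (prodF F G) }) y }) x

  scaleH : Carrier → HGL → HGL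
  scaleH a = map (λ { (b , F) → (a * b , F) })

  -- 𝒯_W(Λ_m) = Σ_T (-1)^{o(T)} T / α(T), T ranging over isomorphism classes of
  -- B₊(•_{a₁},…,•_{aₖ}) with a₁+…+aₖ = m (one representative per partition)
  TΛ : ℕ⁺ → HGL
  TΛ m = map (λ p → (ι (signOver (len p) (autF (corolla p))) , corolla p)) (partitions (val m))

  TWord : List ℕ⁺ → HGL
  TWord [] = unitH
  TWord (m ∷ w) = TΛ m *H TWord w

  𝒯 : NSym → HGL
  𝒯 = concatMap (λ { (a , w) → scaleH a (TWord w) })

{-# OPTIONS --safe #-}
-- A ladder is a tree of \bar{𝕋}^W whose vertices form a path from the root. In 𝒯(Λₘ)·S the
-- leaves of a corolla are grafted onto S, and the result is a ladder only if the corolla has a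
-- single leaf and it is grafted onto the lowest vertex of a ladder S. The one-leaf term of 𝒯(Λₘ)
-- is -•ₘ, so the coefficient of the ladder labelled aₖ,…,a₁ from the top in 𝒯(Λ_{b₁}⋯Λ_{bₗ}) is
-- (-1)ᵏ if the words a and b agree and 0 otherwise. Hence the ladder coefficients of 𝒯(x) are the
-- coefficients of x up to sign.
module Submission where

open import Defs
open import Algebra.Bundles using (CommutativeRing)
open import Algebra.Morphism.Structures using (module RingMorphisms)
open import Data.Bool using (Bool; true; false; _∧_; if_then_else_)
open import Data.Bool.Properties using (∧-zeroʳ; ∧-identityʳ; T-≡)
open import Data.Empty using (⊥-elim)
open import Data.List using (List; []; _∷_; _++_; _∷ʳ_; map; concatMap; filter; length; reverse)
open import Data.List.Properties
  using (map-++; map-cong; map-∘; map-concatMap; concatMap-cong; ++-identityʳ; length-++-≤ʳ; ≡-dec; unfold-reverse)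
open import Data.List.Relation.Unary.All as All using (All; []; _∷_)
open import Data.List.Relation.Unary.All.Properties using (concat⁺; map⁺)
open import Data.Nat using (ℕ; zero; suc; s≤s; z≤n)
open import Data.Nat.ListAction using (sum)
open import Data.Nat.ListAction.Properties using (sum-++)
open import Data.Nat.Properties using (≡ᵇ⇒≡; ≡⇒≡ᵇ)
open import Data.Product using (_,_; proj₁; proj₂)
open import Data.Rational using (ℚ)
open import Function using (_∘_)
open import Function.Bundles using (Equivalence)
open import Level using (0ℓ)
open import Relation.Binary.PropositionalEquality as ≡ using (_≡_; _≢_)
open import Relation.Nullary using (does; yes; no)
open import Relation.Nullary.Decidable using (T?)
open import Relation.Unary using (Pred; Decidable)

==⁺-refl : ∀ a → (a ==⁺ a) ≡ true
==⁺-refl (1+ n) = Equivalence.to T-≡ (≡⇒≡ᵇ n n ≡.refl)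

==⁺-sound : ∀ a b → (a ==⁺ b) ≡ true → a ≡ b
==⁺-sound (1+ m) (1+ n) eq = ≡.cong 1+_ (≡ᵇ⇒≡ m n (Equivalence.from T-≡ eq))

module Grafting where
  open import Data.Nat using (_+_; _≤_)
  open import Data.Nat.Properties using (+-identityʳ; ≤-trans; ≤-reflexive)
  open import Data.Product using (_×_)
  open ≡ using (refl; sym; trans; cong)
  open ≡.≡-Reasoning

  toℕ : Bool → ℕ
  toℕ true = 1
  toℕ false = 0

  count : ∀ {A : Set} → (A → Bool) → List A → ℕ
  count P xs = sum (map (toℕ ∘ P) xs)

  sum-map-++ : ∀ {A : Set} (g : A → ℕ) xs ys → sum (map g (xs ++ ys)) ≡ sum (map g xs) + sum (map g ys)
  sum-map-++ g xs ys = trans (cong sum (map-++ g xs ys)) (sum-++ (map g xs) (map g ys))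

  sum-map-concatMap : ∀ {A B : Set} (g : B → ℕ) (f : A → List B) xs →
    sum (map g (concatMap f xs)) ≡ sum (map (λ x → sum (map g (f x))) xs)
  sum-map-concatMap g f [] = refl
  sum-map-concatMap g f (x ∷ xs) =
    trans (sum-map-++ g (f x) (concatMap f xs)) (cong (sum (map g (f x)) +_) (sum-map-concatMap g f xs))

  sum-map-cong : ∀ {A : Set} {f g : A → ℕ} → (∀ x → f x ≡ g x) → ∀ xs → sum (map f xs) ≡ sum (map g xs)
  sum-map-cong f≗g xs = cong sum (map-cong f≗g xs)

  sum-map-splits-[]ʳ : ∀ {A : Set} (g : List A × List A → ℕ) → (∀ I y J → g (I , y ∷ J) ≡ 0) →
    ∀ xs → sum (map g (splits xs)) ≡ g (xs , [])
  sum-map-splits-[]ʳ g g≡0 [] = +-identityʳ _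
  sum-map-splits-[]ʳ g g≡0 (x ∷ xs) = begin
    sum (map g (splits (x ∷ xs)))
      ≡⟨ sum-map-concatMap g _ (splits xs) ⟩
    sum (map (λ e → g (x ∷ proj₁ e , proj₂ e) + (g (proj₁ e , x ∷ proj₂ e) + 0)) (splits xs))
      ≡⟨ sum-map-cong (λ e → trans (cong (λ n → g (x ∷ proj₁ e , proj₂ e) + (n + 0)) (g≡0 (proj₁ e) x (proj₂ e)))
                                   (+-identityʳ _))
                      (splits xs) ⟩
    sum (map (λ e → g (x ∷ proj₁ e , proj₂ e)) (splits xs))
      ≡⟨ sum-map-splits-[]ʳ _ (λ I y J → g≡0 (x ∷ I) y J) xs ⟩
    g (x ∷ xs , []) ∎

  sum-map-splits-[]ˡ : ∀ {A : Set} (g : List A × List A → ℕ) → (∀ y I J → g (y ∷ I , J) ≡ 0) →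
    ∀ xs → sum (map g (splits xs)) ≡ g ([] , xs)
  sum-map-splits-[]ˡ g g≡0 [] = +-identityʳ _
  sum-map-splits-[]ˡ g g≡0 (x ∷ xs) = begin
    sum (map g (splits (x ∷ xs)))
      ≡⟨ sum-map-concatMap g _ (splits xs) ⟩
    sum (map (λ e → g (x ∷ proj₁ e , proj₂ e) + (g (proj₁ e , x ∷ proj₂ e) + 0)) (splits xs))
      ≡⟨ sum-map-cong (λ e → trans (cong (_+ (g (proj₁ e , x ∷ proj₂ e) + 0)) (g≡0 x (proj₁ e) (proj₂ e)))
                                   (+-identityʳ _))
                      (splits xs) ⟩
    sum (map (λ e → g (proj₁ e , x ∷ proj₂ e)) (splits xs))
      ≡⟨ sum-map-splits-[]ˡ _ (λ y I J → g≡0 y I (x ∷ J)) xs ⟩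
    g ([] , x ∷ xs) ∎

  count-concatMap : ∀ {A B : Set} (P : B → Bool) (f : A → List B) xs →
    count P (concatMap f xs) ≡ sum (map (count P ∘ f) xs)
  count-concatMap P = sum-map-concatMap (toℕ ∘ P)

  count-map : ∀ {A B : Set} (P : B → Bool) (f : A → B) xs → count P (map f xs) ≡ count (P ∘ f) xs
  count-map P f xs = cong sum (sym (map-∘ xs))

  count-cong : ∀ {A : Set} {P Q : A → Bool} → (∀ x → P x ≡ Q x) → ∀ xs → count P xs ≡ count Q xs
  count-cong P≗Q = sum-map-cong (cong toℕ ∘ P≗Q)

  count-none : ∀ {A : Set} {P : A → Bool} {xs} → All (λ x → P x ≡ false) xs → count P xs ≡ 0
  count-none [] = refl
  count-none (Px≡false ∷ pxs) rewrite Px≡false = count-none pxs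

  All-concatMap⁺ : ∀ {A B : Set} {P : Pred B 0ℓ} (f : A → List B) → (∀ x → All P (f x)) →
    ∀ xs → All P (concatMap f xs)
  All-concatMap⁺ f Pf xs = concat⁺ (map⁺ (All.universal Pf xs))

  ladder : List ℕ⁺ → Forest
  ladder [] = []
  ladder (a ∷ u) = node a (ladder u) ∷ []

  isoCount : Forest → List Forest → ℕ
  isoCount L = count (λ X → isoF X L)

  isoF-∷-single : ∀ t ts s → isoF (t ∷ ts) (s ∷ []) ≡ isoT t s ∧ isoF ts []
  isoF-∷-single t ts s with isoT t s
  ... | true = refl
  ... | false = refl

  isoF-single-long : ∀ X s → 2 ≤ length X → isoF X (s ∷ []) ≡ false
  isoF-single-long (_ ∷ []) s (s≤s ())
  isoF-single-long (t ∷ u ∷ X) s _ = trans (isoF-∷-single t (u ∷ X) s) (∧-zeroʳ (isoT t s))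

  isoF-[]-ladder-∷ʳ : ∀ u a → isoF [] (ladder (u ∷ʳ a)) ≡ false
  isoF-[]-ladder-∷ʳ [] a = refl
  isoF-[]-ladder-∷ʳ (_ ∷ _) a = refl

  isoF-corolla-ladder-long : ∀ y q x u a → isoF (corolla (y ∷ q)) (ladder (x ∷ u ∷ʳ a)) ≡ false
  isoF-corolla-ladder-long y q x u a
    rewrite isoF-∷-single (node y []) (corolla q) (node x (ladder (u ∷ʳ a))) | isoF-[]-ladder-∷ʳ u a
    = cong (_∧ isoF (corolla q) []) (∧-zeroʳ (y ==⁺ x))

  -- The last clause of distF only fires once its first argument is in constructor form.
  distF-∷ : ∀ J c cs →
    distF J (c ∷ cs)
      ≡ concatMap (λ e → concatMap (λ c′ → map (c′ ∷_) (distF (proj₂ e) cs)) (graftT (proj₁ e) c)) (splits J)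
  distF-∷ [] c cs = refl
  distF-∷ (_ ∷ _) c cs = refl

  distF-length : ∀ J S → All (λ X → length X ≡ length S) (distF J S)
  distF-length [] [] = refl ∷ []
  distF-length (_ ∷ _) [] = []
  distF-length J (c ∷ cs) rewrite distF-∷ J c cs =
    All-concatMap⁺ _ (λ e → All-concatMap⁺ _ (λ c′ → map⁺ (All.map (cong suc) (distF-length (proj₂ e) cs)))
                                           (graftT (proj₁ e) c))
                   (splits J)

  prodF-length : ∀ F S → All (λ X → length S ≤ length X) (prodF F S)
  prodF-length F S =
    All-concatMap⁺ _ (λ e → map⁺ (All.map (λ {X} eq → ≤-trans (≤-reflexive (sym eq)) (length-++-≤ʳ X {proj₁ e}))
                                          (distF-length (proj₂ e) S)))
                   (splits F)

  graftT-node : ∀ F b ds → graftT F (node b ds) ≡ map (node b) (prodF F ds)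
  graftT-node F b ds = sym (begin
    map (node b) (prodF F ds)
      ≡⟨ map-concatMap (node b) _ (splits F) ⟩
    concatMap (λ e → map (node b) (map (proj₁ e ++_) (distF (proj₂ e) ds))) (splits F)
      ≡⟨ concatMap-cong (λ e → sym (map-∘ (distF (proj₂ e) ds))) (splits F) ⟩
    graftT F (node b ds) ∎)

  count-prodF-[] : ∀ (P : Forest → Bool) F → count P (prodF F []) ≡ toℕ (P F)
  count-prodF-[] P F = begin
    count P (prodF F [])
      ≡⟨ count-concatMap P _ (splits F) ⟩
    sum (map (λ e → count P (map (proj₁ e ++_) (distF (proj₂ e) []))) (splits F))
      ≡⟨ sum-map-splits-[]ʳ _ (λ I y J → refl) F ⟩
    toℕ (P (F ++ [])) + 0
      ≡⟨ trans (+-identityʳ _) (cong (toℕ ∘ P) (++-identityʳ F)) ⟩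
    toℕ (P F) ∎

  count-prodF-long : ∀ (P : Forest → Bool) F S → (∀ X → length S ≤ length X → P X ≡ false) →
    count P (prodF F S) ≡ 0
  count-prodF-long P F S P≡false = count-none (All.map (λ {X} → P≡false X) (prodF-length F S))

  count-prodF-single : ∀ (P : Forest → Bool) F c → (∀ X → 2 ≤ length X → P X ≡ false) →
    count P (prodF F (c ∷ [])) ≡ count P (distF F (c ∷ []))
  count-prodF-single P F c P≡false = begin
    count P (prodF F (c ∷ []))
      ≡⟨ count-concatMap P _ (splits F) ⟩
    sum (map (λ e → count P (map (proj₁ e ++_) (distF (proj₂ e) (c ∷ [])))) (splits F))
      ≡⟨ sum-map-splits-[]ˡ _ besideRoot F ⟩
    count P (map ([] ++_) (distF F (c ∷ [])))
      ≡⟨ count-map P _ (distF F (c ∷ [])) ⟩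
    count P (distF F (c ∷ [])) ∎
    where
    besideRoot : ∀ y I J → count P (map ((y ∷ I) ++_) (distF J (c ∷ []))) ≡ 0
    besideRoot y I J = count-none (map⁺ (All.map long (distF-length J (c ∷ []))))
      where
      long : ∀ {X} → length X ≡ 1 → P ((y ∷ I) ++ X) ≡ false
      long {X} len≡1 = P≡false _ (s≤s (≤-trans (≤-reflexive (sym len≡1)) (length-++-≤ʳ X {I})))

  count-distF-single : ∀ (P : Forest → Bool) F c →
    count P (distF F (c ∷ [])) ≡ count (λ c′ → P (c′ ∷ [])) (graftT F c)
  count-distF-single P F c = begin
    count P (distF F (c ∷ []))
      ≡⟨ cong (count P) (distF-∷ F c []) ⟩
    count P (concatMap (λ e → concatMap (λ c′ → map (c′ ∷_) (distF (proj₂ e) [])) (graftT (proj₁ e) c)) (splits F))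
      ≡⟨ count-concatMap P _ (splits F) ⟩
    sum (map (λ e → count P (concatMap (λ c′ → map (c′ ∷_) (distF (proj₂ e) [])) (graftT (proj₁ e) c))) (splits F))
      ≡⟨ sum-map-splits-[]ʳ _ (λ I y J → count-none (All-concatMap⁺ _ (λ _ → []) (graftT I c))) F ⟩
    count P (concatMap (λ c′ → (c′ ∷ []) ∷ []) (graftT F c))
      ≡⟨ count-concatMap P _ (graftT F c) ⟩
    sum (map (λ c′ → toℕ (P (c′ ∷ [])) + 0) (graftT F c))
      ≡⟨ sum-map-cong (λ c′ → +-identityʳ _) (graftT F c) ⟩
    count (λ c′ → P (c′ ∷ [])) (graftT F c) ∎

  isoCount-[]-prodF : ∀ t F S → isoCount [] (prodF (t ∷ F) S) ≡ 0
  isoCount-[]-prodF t F [] = count-prodF-[] _ (t ∷ F)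
  isoCount-[]-prodF t F (c ∷ cs) = count-prodF-long _ (t ∷ F) (c ∷ cs) λ { (_ ∷ _) _ → refl }

  isoCount-ladder-prodF-single : ∀ x u F b ds →
    isoCount (ladder (x ∷ u)) (prodF F (node b ds ∷ [])) ≡ (if b ==⁺ x then isoCount (ladder u) (prodF F ds) else 0)
  isoCount-ladder-prodF-single x u F b ds = begin
    isoCount (ladder (x ∷ u)) (prodF F (node b ds ∷ []))
      ≡⟨ count-prodF-single _ F (node b ds) (λ X → isoF-single-long X _) ⟩
    isoCount (ladder (x ∷ u)) (distF F (node b ds ∷ []))
      ≡⟨ count-distF-single _ F (node b ds) ⟩
    count (λ c′ → isoF (c′ ∷ []) (ladder (x ∷ u))) (graftT F (node b ds))
      ≡⟨ cong (count _) (graftT-node F b ds) ⟩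
    count (λ c′ → isoF (c′ ∷ []) (ladder (x ∷ u))) (map (node b) (prodF F ds))
      ≡⟨ count-map _ (node b) (prodF F ds) ⟩
    count (λ X → isoF (node b X ∷ []) (ladder (x ∷ u))) (prodF F ds)
      ≡⟨ count-cong (λ X → trans (isoF-∷-single (node b X) [] _) (∧-identityʳ _)) (prodF F ds) ⟩
    count (λ X → (b ==⁺ x) ∧ isoF X (ladder u)) (prodF F ds)
      ≡⟨ guarded (b ==⁺ x) ⟩
    (if b ==⁺ x then isoCount (ladder u) (prodF F ds) else 0) ∎
    where
    guarded : ∀ β →
      count (λ X → β ∧ isoF X (ladder u)) (prodF F ds) ≡ (if β then isoCount (ladder u) (prodF F ds) else 0)
    guarded true = refl
    guarded false = count-none (All.universal (λ _ → refl) (prodF F ds))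

  isoCount-ladder-prodF-long : ∀ x u F c₁ c₂ cs → isoCount (ladder (x ∷ u)) (prodF F (c₁ ∷ c₂ ∷ cs)) ≡ 0
  isoCount-ladder-prodF-long x u F c₁ c₂ cs =
    count-prodF-long _ F (c₁ ∷ c₂ ∷ cs) (λ X → isoF-single-long X _ ∘ ≤-trans (s≤s (s≤s z≤n)))

  isoCount-ladder-single-prodF-corolla : ∀ a y q S → let F = corolla (y ∷ q) in
    isoCount (ladder (a ∷ [])) (prodF F S) ≡ toℕ (isoF F (ladder (a ∷ [])) ∧ isoF S [])
  isoCount-ladder-single-prodF-corolla a y q [] =
    trans (count-prodF-[] _ (corolla (y ∷ q))) (cong toℕ (sym (∧-identityʳ _)))
  isoCount-ladder-single-prodF-corolla a y q (node b ds ∷ []) =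
    trans (isoCount-ladder-prodF-single a [] (corolla (y ∷ q)) b ds)
          (trans (noRoot (b ==⁺ a)) (cong toℕ (sym (∧-zeroʳ _))))
    where
    noRoot : ∀ β → (if β then isoCount [] (prodF (corolla (y ∷ q)) ds) else 0) ≡ 0
    noRoot true = isoCount-[]-prodF _ (corolla q) ds
    noRoot false = refl
  isoCount-ladder-single-prodF-corolla a y q (c₁ ∷ c₂ ∷ cs) =
    trans (isoCount-ladder-prodF-long a [] (corolla (y ∷ q)) c₁ c₂ cs) (cong toℕ (sym (∧-zeroʳ _)))

  isoCount-ladder-∷ʳ-prodF-corolla : ∀ u a y q S → let F = corolla (y ∷ q) in
    isoCount (ladder (u ∷ʳ a)) (prodF F S) ≡ toℕ (isoF F (ladder (a ∷ [])) ∧ isoF S (ladder u))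
  isoCount-ladder-∷ʳ-prodF-corolla [] a y q S = isoCount-ladder-single-prodF-corolla a y q S
  isoCount-ladder-∷ʳ-prodF-corolla (x ∷ u) a y q [] =
    trans (count-prodF-[] _ (corolla (y ∷ q)))
          (cong toℕ (trans (isoF-corolla-ladder-long y q x u a) (sym (∧-zeroʳ _))))
  isoCount-ladder-∷ʳ-prodF-corolla (x ∷ u) a y q (node b ds ∷ []) = begin
    isoCount (ladder (x ∷ u ∷ʳ a)) (prodF (corolla (y ∷ q)) (node b ds ∷ []))
      ≡⟨ isoCount-ladder-prodF-single x (u ∷ʳ a) (corolla (y ∷ q)) b ds ⟩
    (if b ==⁺ x then isoCount (ladder (u ∷ʳ a)) (prodF (corolla (y ∷ q)) ds) else 0)
      ≡⟨ cong (if b ==⁺ x then_else 0) (isoCount-ladder-∷ʳ-prodF-corolla u a y q ds) ⟩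
    (if b ==⁺ x then toℕ (β ∧ isoF ds (ladder u)) else 0)
      ≡⟨ onRoot (b ==⁺ x) ⟩
    toℕ (β ∧ (((b ==⁺ x) ∧ isoF ds (ladder u)) ∧ isoF [] []))
      ≡⟨ cong (λ γ → toℕ (β ∧ γ)) (sym (isoF-∷-single (node b ds) [] _)) ⟩
    toℕ (β ∧ isoF (node b ds ∷ []) (ladder (x ∷ u))) ∎
    where
    β = isoF (corolla (y ∷ q)) (ladder (a ∷ []))
    onRoot : ∀ γ →
      (if γ then toℕ (β ∧ isoF ds (ladder u)) else 0) ≡ toℕ (β ∧ ((γ ∧ isoF ds (ladder u)) ∧ true))
    onRoot true = cong (λ δ → toℕ (β ∧ δ)) (sym (∧-identityʳ _))
    onRoot false = cong toℕ (sym (∧-zeroʳ β))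
  isoCount-ladder-∷ʳ-prodF-corolla (x ∷ u) a y q (c₁ ∷ c₂ ∷ cs) =
    trans (isoCount-ladder-prodF-long x (u ∷ʳ a) (corolla (y ∷ q)) c₁ c₂ cs)
          (cong toℕ (sym (trans (cong (_ ∧_) (isoF-single-long (c₁ ∷ c₂ ∷ cs) _ (s≤s (s≤s z≤n))))
                                (∧-zeroʳ _))))

open Grafting

module Ladders {c ℓ} (K : CommutativeRing c ℓ) (ι : ℚ → CommutativeRing.Carrier K) (isℚAlgebra : IsℚAlgebra K ι)
  where
  open CommutativeRing K
  open Construction K ι
  open import Algebra.Properties.Ring ring using (-1*x≈-x; -‿distribˡ-*; -‿injective; -0#≈0#)
  open import Algebra.Properties.Monoid.Mult +-monoid using (_×_; ×-homo-1)
  open import Algebra.Properties.CommutativeSemigroup +-commutativeSemigroup using (interchange)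
  open import Relation.Binary.Reasoning.Setoid setoid
  open RingMorphisms.IsRingHomomorphism isℚAlgebra using (-‿homo; 1#-homo)

  ∑ : ∀ {α} {A : Set α} → List A → (A → Carrier) → Carrier
  ∑ [] f = 0#
  ∑ (x ∷ xs) f = f x + ∑ xs f

  syntax ∑ xs (λ x → e) = ∑[ x ∈ xs ] e

  ∑-cong : ∀ {α} {A : Set α} {f g : A → Carrier} → (∀ x → f x ≈ g x) → ∀ xs → ∑ xs f ≈ ∑ xs g
  ∑-cong f≈g [] = refl
  ∑-cong f≈g (x ∷ xs) = +-cong (f≈g x) (∑-cong f≈g xs)

  ∑-zero : ∀ {α} {A : Set α} {f : A → Carrier} → (∀ x → f x ≈ 0#) → ∀ xs → ∑ xs f ≈ 0#
  ∑-zero f≈0 xs = trans (∑-cong f≈0 xs) (zeros xs)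
    where
    zeros : ∀ xs → ∑[ x ∈ xs ] 0# ≈ 0#
    zeros [] = refl
    zeros (x ∷ xs) = trans (+-identityˡ _) (zeros xs)

  ∑-+ : ∀ {α} {A : Set α} (f g : A → Carrier) → ∀ xs → ∑[ x ∈ xs ] (f x + g x) ≈ ∑ xs f + ∑ xs g
  ∑-+ f g [] = sym (+-identityˡ 0#)
  ∑-+ f g (x ∷ xs) = trans (+-congˡ (∑-+ f g xs)) (interchange (f x) (g x) (∑ xs f) (∑ xs g))

  ∑-++ : ∀ {α} {A : Set α} (f : A → Carrier) → ∀ xs ys → ∑ (xs ++ ys) f ≈ ∑ xs f + ∑ ys f
  ∑-++ f [] ys = sym (+-identityˡ _)
  ∑-++ f (x ∷ xs) ys = trans (+-congˡ (∑-++ f xs ys)) (sym (+-assoc _ _ _))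

  ∑-concatMap : ∀ {α β} {A : Set α} {B : Set β} (f : B → Carrier) (h : A → List B) →
    ∀ xs → ∑ (concatMap h xs) f ≈ ∑[ x ∈ xs ] ∑ (h x) f
  ∑-concatMap f h [] = refl
  ∑-concatMap f h (x ∷ xs) = trans (∑-++ f (h x) (concatMap h xs)) (+-congˡ (∑-concatMap f h xs))

  ∑-map : ∀ {α β} {A : Set α} {B : Set β} (f : B → Carrier) (h : A → B) →
    ∀ xs → ∑ (map h xs) f ≡ ∑ xs (f ∘ h)
  ∑-map f h [] = ≡.refl
  ∑-map f h (x ∷ xs) = ≡.cong (f (h x) +_) (∑-map f h xs)

  ∑-filter : ∀ {α} {A : Set α} {P : Pred A 0ℓ} (P? : Decidable P) (f : A → Carrier) →
    (∀ x → does (P? x) ≡ false → f x ≈ 0#) → ∀ xs → ∑ (filter P? xs) f ≈ ∑ xs f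
  ∑-filter P? f f≈0 [] = refl
  ∑-filter P? f f≈0 (x ∷ xs) with does (P? x) in eq
  ... | true = +-congˡ (∑-filter P? f f≈0 xs)
  ... | false = trans (∑-filter P? f f≈0 xs) (sym (trans (+-congʳ (f≈0 x eq)) (+-identityˡ _)))

  ∑-compositions : ∀ n (f : List ℕ⁺ → Carrier) → (∀ a b r → f (a ∷ b ∷ r) ≈ 0#) →
    ∑ (compositions (suc n)) f ≈ f ((1+ n) ∷ [])
  ∑-compositions zero f f≈0 = +-identityʳ _
  ∑-compositions (suc n) f f≈0 = begin
    ∑ (concatMap (λ c → (1+ 0 ∷ c) ∷ inc c ∷ []) (compositions (suc n))) f
      ≈⟨ ∑-concatMap f _ (compositions (suc n)) ⟩
    ∑[ c ∈ compositions (suc n) ] (f (1+ 0 ∷ c) + (f (inc c) + 0#))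
      ≈⟨ ∑-cong (λ c → +-congˡ (+-identityʳ _)) (compositions (suc n)) ⟩
    ∑[ c ∈ compositions (suc n) ] (f (1+ 0 ∷ c) + f (inc c))
      ≈⟨ ∑-+ (f ∘ (1+ 0 ∷_)) (f ∘ inc) (compositions (suc n)) ⟩
    ∑ (compositions (suc n)) (f ∘ (1+ 0 ∷_)) + ∑ (compositions (suc n)) (f ∘ inc)
      ≈⟨ +-cong (∑-compositions n _ (λ a b r → f≈0 (1+ 0) a (b ∷ r)))
                (∑-compositions n _ λ { (1+ k) b r → f≈0 (1+ suc k) b r }) ⟩
    f (1+ 0 ∷ 1+ n ∷ []) + f (1+ suc n ∷ [])
      ≈⟨ trans (+-congʳ (f≈0 (1+ 0) (1+ n) [])) (+-identityˡ _) ⟩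
    f (1+ suc n ∷ []) ∎

  ∑-partitions : ∀ m (f : List ℕ⁺ → Carrier) → (∀ a b r → f (a ∷ b ∷ r) ≈ 0#) →
    ∑ (partitions (val m)) f ≈ f (m ∷ [])
  ∑-partitions (1+ n) f f≈0 =
    trans (∑-filter (T? ∘ nonincreasing) f (λ { (a ∷ b ∷ r) _ → f≈0 a b r }) (compositions (suc n)))
          (∑-compositions n f f≈0)

  coeffH-++ : ∀ L (x y : HGL) → coeffH L (x ++ y) ≈ coeffH L x + coeffH L y
  coeffH-++ L [] y = sym (+-identityˡ _)
  coeffH-++ L ((a , G) ∷ x) y with isoF G L
  ... | true = trans (+-congˡ (coeffH-++ L x y)) (sym (+-assoc _ _ _))
  ... | false = coeffH-++ L x y

  coeffH-concatMap : ∀ {α} {A : Set α} L (h : A → HGL) xs →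
    coeffH L (concatMap h xs) ≈ ∑[ x ∈ xs ] coeffH L (h x)
  coeffH-concatMap L h [] = refl
  coeffH-concatMap L h (x ∷ xs) = trans (coeffH-++ L (h x) (concatMap h xs)) (+-congˡ (coeffH-concatMap L h xs))

  coeffH-map : ∀ L a Xs → coeffH L (map (a ,_) Xs) ≈ isoCount L Xs × a
  coeffH-map L a [] = refl
  coeffH-map L a (X ∷ Xs) with isoF X L
  ... | true = +-congˡ (coeffH-map L a Xs)
  ... | false = coeffH-map L a Xs

  termProductCoeff : Forest → Carrier → Forest → HGL → Carrier
  termProductCoeff L a F y = ∑[ bG ∈ y ] (isoCount L (prodF F (proj₂ bG)) × (a * proj₁ bG))

  coeffH-*H : ∀ L x y → coeffH L (x *H y) ≈ ∑[ aF ∈ x ] termProductCoeff L (proj₁ aF) (proj₂ aF) y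
  coeffH-*H L x y =
    trans (coeffH-concatMap L _ x)
          (∑-cong (λ aF → trans (coeffH-concatMap L _ y)
                                (∑-cong (λ bG → coeffH-map L _ (prodF (proj₂ aF) (proj₂ bG))) y))
                  x)

  coeffH-scaleH : ∀ L a x → coeffH L (scaleH a x) ≈ a * coeffH L x
  coeffH-scaleH L a [] = sym (zeroʳ a)
  coeffH-scaleH L a ((b , G) ∷ x) with isoF G L
  ... | true = trans (+-congˡ (coeffH-scaleH L a x)) (sym (distribˡ a b _))
  ... | false = coeffH-scaleH L a x

  corollaCoeff : List ℕ⁺ → Carrier
  corollaCoeff p = ι (signOver (len p) (autF (corolla p)))

  -- autF of a one-leaf corolla computes to 1, so this coefficient is ι(-1) by definition.
  corollaCoeff-single : ∀ a → corollaCoeff (a ∷ []) ≈ - 1#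
  corollaCoeff-single a = trans (-‿homo _) (-‿cong 1#-homo)

  ∑-indicator-isoF : ∀ c L y → ∑[ bG ∈ y ] (toℕ (isoF (proj₂ bG) L) × (c * proj₁ bG)) ≈ c * coeffH L y
  ∑-indicator-isoF c L [] = sym (zeroʳ c)
  ∑-indicator-isoF c L ((b , G) ∷ y) with isoF G L
  ... | true = trans (+-cong (×-homo-1 _) (∑-indicator-isoF c L y)) (sym (distribˡ c b _))
  ... | false = trans (+-identityˡ _) (∑-indicator-isoF c L y)

  coeffH-TΛ*H : ∀ L m y → (∀ a b r G → isoCount L (prodF (corolla (a ∷ b ∷ r)) G) ≡ 0) →
    coeffH L (TΛ m *H y) ≈ termProductCoeff L (corollaCoeff (m ∷ [])) (corolla (m ∷ [])) y
  coeffH-TΛ*H L m y isoCount≡0 = begin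
    coeffH L (TΛ m *H y)
      ≈⟨ coeffH-*H L (TΛ m) y ⟩
    ∑[ aF ∈ TΛ m ] termProductCoeff L (proj₁ aF) (proj₂ aF) y
      ≡⟨ ∑-map _ _ (partitions (val m)) ⟩
    ∑[ p ∈ partitions (val m) ] termProductCoeff L (corollaCoeff p) (corolla p) y
      ≈⟨ ∑-partitions m _ (λ a b r → ∑-zero (λ bG → reflexive (≡.cong (_× _) (isoCount≡0 a b r (proj₂ bG)))) y) ⟩
    termProductCoeff L (corollaCoeff (m ∷ [])) (corolla (m ∷ [])) y ∎

  coeffH-[]-TΛ*H : ∀ m y → coeffH [] (TΛ m *H y) ≈ 0#
  coeffH-[]-TΛ*H m y =
    trans (coeffH-TΛ*H [] m y (λ a b r → isoCount-[]-prodF (node a []) (corolla (b ∷ r))))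
          (∑-zero (λ bG → reflexive (≡.cong (_× (corollaCoeff (m ∷ []) * proj₁ bG))
                                            (isoCount-[]-prodF (node m []) [] (proj₂ bG))))
                  y)

  coeffH-ladder-∷ʳ-TΛ*H : ∀ u a m y →
    coeffH (ladder (u ∷ʳ a)) (TΛ m *H y) ≈ (if m ==⁺ a then - coeffH (ladder u) y else 0#)
  coeffH-ladder-∷ʳ-TΛ*H u a m y = begin
    coeffH (ladder (u ∷ʳ a)) (TΛ m *H y)
      ≈⟨ coeffH-TΛ*H _ m y twoLeaves ⟩
    termProductCoeff (ladder (u ∷ʳ a)) (corollaCoeff (m ∷ [])) (corolla (m ∷ [])) y
      ≈⟨ ∑-cong (λ bG → reflexive (≡.cong (_× _) (oneLeaf (proj₂ bG)))) y ⟩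
    ∑[ bG ∈ y ] (toℕ ((m ==⁺ a) ∧ isoF (proj₂ bG) (ladder u)) × (corollaCoeff (m ∷ []) * proj₁ bG))
      ≈⟨ guarded (m ==⁺ a) ⟩
    (if m ==⁺ a then - coeffH (ladder u) y else 0#) ∎
    where
    twoLeaves : ∀ a′ b r G → isoCount (ladder (u ∷ʳ a)) (prodF (corolla (a′ ∷ b ∷ r)) G) ≡ 0
    twoLeaves a′ b r G =
      ≡.trans (isoCount-ladder-∷ʳ-prodF-corolla u a a′ (b ∷ r) G)
              (≡.cong (λ β → toℕ (β ∧ isoF G (ladder u)))
                      (isoF-single-long (corolla (a′ ∷ b ∷ r)) (node a []) (s≤s (s≤s z≤n))))
    oneLeaf : ∀ G →
      isoCount (ladder (u ∷ʳ a)) (prodF (corolla (m ∷ [])) G) ≡ toℕ ((m ==⁺ a) ∧ isoF G (ladder u))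
    oneLeaf G =
      ≡.trans (isoCount-ladder-∷ʳ-prodF-corolla u a m [] G)
              (≡.cong (λ β → toℕ (β ∧ isoF G (ladder u)))
                      (≡.trans (isoF-∷-single (node m []) [] (node a [])) (≡.trans (∧-identityʳ _) (∧-identityʳ _))))
    guarded : ∀ β → ∑[ bG ∈ y ] (toℕ (β ∧ isoF (proj₂ bG) (ladder u)) × (corollaCoeff (m ∷ []) * proj₁ bG))
                    ≈ (if β then - coeffH (ladder u) y else 0#)
    guarded true = trans (∑-indicator-isoF _ (ladder u) y) (trans (*-congʳ (corollaCoeff-single m)) (-1*x≈-x _))
    guarded false = ∑-zero (λ _ → refl) y

  sign : List ℕ⁺ → Carrier
  sign [] = 1#
  sign (_ ∷ w) = - sign w

  sign-*-cancelˡ : ∀ w {a b} → sign w * a ≈ sign w * b → a ≈ b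
  sign-*-cancelˡ [] {a} {b} eq = trans (sym (*-identityˡ a)) (trans eq (*-identityˡ b))
  sign-*-cancelˡ (_ ∷ w) eq =
    sign-*-cancelˡ w (-‿injective (trans (-‿distribˡ-* _ _) (trans eq (sym (-‿distribˡ-* _ _)))))

  coeffH-ladder-TWord-≡ : ∀ w → coeffH (ladder (reverse w)) (TWord w) ≈ sign w
  coeffH-ladder-TWord-≡ [] = +-identityʳ 1#
  coeffH-ladder-TWord-≡ (a ∷ w) = begin
    coeffH (ladder (reverse (a ∷ w))) (TΛ a *H TWord w)
      ≡⟨ ≡.cong (λ u → coeffH (ladder u) (TΛ a *H TWord w)) (unfold-reverse a w) ⟩
    coeffH (ladder (reverse w ∷ʳ a)) (TΛ a *H TWord w)
      ≈⟨ coeffH-ladder-∷ʳ-TΛ*H (reverse w) a a (TWord w) ⟩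
    (if a ==⁺ a then - coeffH (ladder (reverse w)) (TWord w) else 0#)
      ≡⟨ ≡.cong (if_then - coeffH (ladder (reverse w)) (TWord w) else 0#) (==⁺-refl a) ⟩
    - coeffH (ladder (reverse w)) (TWord w)
      ≈⟨ -‿cong (coeffH-ladder-TWord-≡ w) ⟩
    - sign w ∎

  coeffH-ladder-TWord-≢ : ∀ w w′ → w ≢ w′ → coeffH (ladder (reverse w)) (TWord w′) ≈ 0#
  coeffH-ladder-TWord-≢ [] [] w≢w′ = ⊥-elim (w≢w′ ≡.refl)
  coeffH-ladder-TWord-≢ [] (m ∷ w′) _ = coeffH-[]-TΛ*H m (TWord w′)
  coeffH-ladder-TWord-≢ (a ∷ w) [] _ rewrite unfold-reverse a w | isoF-[]-ladder-∷ʳ (reverse w) a = refl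
  coeffH-ladder-TWord-≢ (a ∷ w) (m ∷ w′) w≢w′ rewrite unfold-reverse a w =
    trans (coeffH-ladder-∷ʳ-TΛ*H (reverse w) a m (TWord w′)) (guarded (m ==⁺ a) (==⁺-sound m a))
    where
    guarded : ∀ β → (β ≡ true → m ≡ a) → (if β then - coeffH (ladder (reverse w)) (TWord w′) else 0#) ≈ 0#
    guarded true m≡a =
      trans (-‿cong (coeffH-ladder-TWord-≢ w w′ (w≢w′ ∘ ≡.cong₂ _∷_ (≡.sym (m≡a ≡.refl))))) -0#≈0#
    guarded false _ = refl

  coeffH-ladder-𝒯 : ∀ w x → coeffH (ladder (reverse w)) (𝒯 x) ≈ sign w * coeffN w x
  coeffH-ladder-𝒯 w [] = sym (zeroʳ _)
  coeffH-ladder-𝒯 w ((a , w′) ∷ x) with ≡-dec _≟⁺_ w′ w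
  ... | yes ≡.refl = begin
    coeffH L (scaleH a (TWord w) ++ 𝒯 x)
      ≈⟨ coeffH-++ L (scaleH a (TWord w)) (𝒯 x) ⟩
    coeffH L (scaleH a (TWord w)) + coeffH L (𝒯 x)
      ≈⟨ +-cong (trans (coeffH-scaleH L a (TWord w)) (*-congˡ (coeffH-ladder-TWord-≡ w)))
                (coeffH-ladder-𝒯 w x) ⟩
    a * sign w + sign w * coeffN w x
      ≈⟨ +-congʳ (*-comm a (sign w)) ⟩
    sign w * a + sign w * coeffN w x
      ≈⟨ distribˡ (sign w) a (coeffN w x) ⟨
    sign w * (a + coeffN w x) ∎
    where L = ladder (reverse w)
  ... | no w′≢w = begin
    coeffH L (scaleH a (TWord w′) ++ 𝒯 x)
      ≈⟨ coeffH-++ L (scaleH a (TWord w′)) (𝒯 x) ⟩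
    coeffH L (scaleH a (TWord w′)) + coeffH L (𝒯 x)
      ≈⟨ +-cong (trans (coeffH-scaleH L a (TWord w′)) (*-congˡ (coeffH-ladder-TWord-≢ w w′ (w′≢w ∘ ≡.sym))))
                (coeffH-ladder-𝒯 w x) ⟩
    a * 0# + sign w * coeffN w x
      ≈⟨ trans (+-congʳ (zeroʳ a)) (+-identityˡ _) ⟩
    sign w * coeffN w x ∎
    where L = ladder (reverse w)

theorem5p1 : ∀ {c ℓ} (K : CommutativeRing c ℓ) (ι : ℚ → CommutativeRing.Carrier K) →
    IsℚAlgebra K ι →
    (x y : Construction.NSym K ι) →
    Construction._≈H_ K ι (Construction.𝒯 K ι x) (Construction.𝒯 K ι y) →
    Construction._≈N_ K ι x y
theorem5p1 K ι isℚAlgebra x y 𝒯x≈𝒯y w = sign-*-cancelˡ w (begin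
  sign w * coeffN w x       ≈⟨ coeffH-ladder-𝒯 w x ⟨
  coeffH L (𝒯 x)            ≈⟨ 𝒯x≈𝒯y L ⟩
  coeffH L (𝒯 y)            ≈⟨ coeffH-ladder-𝒯 w y ⟩
  sign w * coeffN w y       ∎)
  where
  open CommutativeRing K
  open Construction K ι
  open Ladders K ι isℚAlgebra
  open import Relation.Binary.Reasoning.Setoid setoid
  L = ladder (reverse w)
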